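{- Let $0<|q|<1$, let $c\neq 0$ be a complex number, and let $r,s\ge 0$ be integers. Then $$\sum_{k=0}^{r}\begin{bmatrix}r+s-k\\ r-k\end{bmatrix}_q q^{(s+1)k}(c;q)_k=(c^{ -1};q^{ -1})_{1+s}\,(cq^{1+s};q)_r+c^{ -1}\sum_{k=0}^{s}\begin{bmatrix}r+s-k\\ s-k\end{bmatrix}_q (c^{ -1};q^{ -1})_k\,q^{ -k}.$$
   Context: For complex $x$ and integer $n\ge 0$: $(x;q)_n=\prod_{j=0}^{n-1}(1-xq^j)$ and $(x;q^{ -1})_n=\prod_{j=0}^{n-1}(1-xq^{ -j})$. The $q$-binomial coefficient is $\begin{bmatrix}n\\ k\end{bmatrix}_q=\frac{(q;q)_n}{(q;q)_k(q;q)_{n-k}}$. -}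

module Defs where

open import Level using (Level; _⊔_) renaming (suc to lsuc)
open import Data.Nat using (ℕ; zero; suc; _∸_)
open import Relation.Nullary using (¬_)
open import Algebra.Bundles using (CommutativeRing)

-- A field: a commutative ring with 0 ≠ 1 in which every nonzero element
-- has a multiplicative inverse (the inverse function is total; its value
-- at 0 is irrelevant).  ℂ is an instance.
record Field (a ℓ : Level) : Set (lsuc (a ⊔ ℓ)) where
  field
    commutativeRing : CommutativeRing a ℓ
  open CommutativeRing commutativeRing public
  field
    _⁻¹       : Carrier → Carrier
    ⁻¹-inverse : ∀ x → ¬ (x ≈ 0#) → x * (x ⁻¹) ≈ 1#
    0≉1       : ¬ (0# ≈ 1#)

module FieldDefs {a ℓ : Level} (F : Field a ℓ) where
  open Field F using (Carrier; _+_; _*_; _-_; 1#; _⁻¹)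

  pow : Carrier → ℕ → Carrier
  pow x zero    = 1#
  pow x (suc n) = pow x n * x

  -- (x; q)_n = ∏_{j=0}^{n-1} (1 - x q^j).  (x; q^{-1})_n is  poch x (q ⁻¹) n.
  poch : Carrier → Carrier → ℕ → Carrier
  poch x q zero    = 1#
  poch x q (suc n) = poch x q n * (1# - x * pow q n)

  qbinom : Carrier → ℕ → ℕ → Carrier
  qbinom q n k = poch q q n * ((poch q q k) ⁻¹ * (poch q q (n ∸ k)) ⁻¹)

  sumTo : ℕ → (ℕ → Carrier) → Carrier
  sumTo zero    f = f zero
  sumTo (suc r) f = sumTo r f + f (suc r)

-- Replace each q-binomial [a+b, a]_q by the Gaussian coefficient
-- gauss a b, defined by the q-Pascal rule
--   gauss (a+1) (b+1) = gauss a (b+1) + q^{a+1} gauss (a+1) b.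
-- Both sides then become functions L r s and R r s satisfying the same
-- Pascal-type recurrence  F (r+1) (s+1) = F r (s+1) + q^{r+1} F (r+1) s,
-- termwise for the sums and via (x;q)_{n+1} = (1-x)(xq;q)_n for the product.
-- On the axes they agree: for r = 0 both equal 1 (a telescoping sum), and for
-- s = 0 both equal (1-c⁻¹)(cq;q)_r + c⁻¹.  Such a recurrence determines a
-- function from its values on the axes, so L = R.
module Submission where

open import Level using (Level; 0ℓ)
open import Algebra.Bundles using (CommutativeRing; RawRing)
open import Algebra.Solver.Ring.AlmostCommutativeRing using (fromCommutativeRing; _-Raw-AlmostCommutative⟶_)
open import Data.List using ([]; _∷_)
open import Data.Maybe using (Maybe; just; nothing)
open import Data.Nat as ℕ using (ℕ; zero; suc; _∸_)
import Data.Nat.Properties as ℕP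
open import Data.Nat.Tactic.RingSolver using () renaming (solve to ℕsolve)
open import Data.Product using (_×_; _,_)
open import Relation.Nullary using (¬_; yes; no)
open import Relation.Binary.PropositionalEquality as ≡ using (_≡_)
open import Defs

-- We take the integers, presented as pairs (a , b) of
-- naturals standing for a - b and kept in the normal form where one
-- component is zero; this lets the solver cancel terms such as x - x,
-- which a solver with natural-number coefficients cannot do.
module IntegerCoefficientSolver {c ℓ : Level} (R : CommutativeRing c ℓ) where
  open CommutativeRing R
  open import Algebra.Properties.Ring ring using (-‿distribˡ-*; -‿distribʳ-*; -‿involutive; -0#≈0#)
  open import Algebra.Properties.AbelianGroup +-abelianGroup using (⁻¹-∙-comm; ⁻¹-anti-homo‿-)
  open import Algebra.Properties.Semiring.Mult.TCOptimised semiring using (×-homo-+; ×1-homo-*) renaming (_×_ to _×ᴿ_)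
  open import Relation.Binary.Reasoning.Setoid setoid
  open import Algebra.Solver.Ring.NaturalCoefficients.Default commutativeSemiring
    using () renaming (solve to semiring-solve; _:=_ to _:=ˢ_; _:+_ to _:+ˢ_; _:*_ to _:*ˢ_)

  sub-+-interchange : ∀ a b c d → (a + c) - (b + d) ≈ (a - b) + (c - d)
  sub-+-interchange a b c d = begin
    (a + c) + - (b + d)    ≈⟨ +-congˡ (⁻¹-∙-comm b d) ⟨
    (a + c) + (- b + - d)  ≈⟨ semiring-solve 4 (λ a c b′ d′ → (a :+ˢ c) :+ˢ (b′ :+ˢ d′) :=ˢ (a :+ˢ b′) :+ˢ (c :+ˢ d′)) refl a c (- b) (- d) ⟩
    (a - b) + (c - d)      ∎

  sub-cancel : ∀ {a b c d} → a + d ≈ c + b → a - b ≈ c - d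
  sub-cancel {a} {b} {c} {d} a+d≈c+b = begin
    a - b                ≈⟨ +-identityʳ _ ⟨
    (a - b) + 0#         ≈⟨ +-congˡ (-‿inverseʳ d) ⟨
    (a - b) + (d - d)    ≈⟨ sub-+-interchange a b d d ⟨
    (a + d) - (b + d)    ≈⟨ +-cong a+d≈c+b (-‿cong (+-comm b d)) ⟩
    (c + b) - (d + b)    ≈⟨ sub-+-interchange c d b b ⟩
    (c - d) + (b - b)    ≈⟨ +-congˡ (-‿inverseʳ b) ⟩
    (c - d) + 0#         ≈⟨ +-identityʳ _ ⟩
    c - d                ∎

  sub-*-expand : ∀ a b c d → (a * c + b * d) - (a * d + b * c) ≈ (a - b) * (c - d)
  sub-*-expand a b c d = begin
    (a * c + b * d) - (a * d + b * c)             ≈⟨ +-congˡ (⁻¹-∙-comm (a * d) (b * c)) ⟨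
    (a * c + b * d) + (- (a * d) + - (b * c))     ≈⟨ +-cong (+-congˡ negated-product) (+-cong (-‿distribʳ-* a d) (-‿distribˡ-* b c)) ⟩
    (a * c + - b * - d) + (a * - d + - b * c)     ≈⟨ semiring-solve 4 (λ a b′ c d′ → (a :*ˢ c :+ˢ b′ :*ˢ d′) :+ˢ (a :*ˢ d′ :+ˢ b′ :*ˢ c) :=ˢ (a :+ˢ b′) :*ˢ (c :+ˢ d′)) refl a (- b) c (- d) ⟩
    (a - b) * (c - d)                             ∎
    where
    negated-product : b * d ≈ - b * - d
    negated-product = begin
      b * d          ≈⟨ -‿involutive _ ⟨
      - - (b * d)    ≈⟨ -‿cong (-‿distribʳ-* b d) ⟩
      - (b * - d)    ≈⟨ -‿distribˡ-* b (- d) ⟩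
      - b * - d      ∎

  ι : ℕ → Carrier
  ι n = n ×ᴿ 1#

  ℤ₂ : Set
  ℤ₂ = ℕ × ℕ

  normalise : ℤ₂ → ℤ₂
  normalise (a , b) = (a ∸ b , b ∸ a)

  difference : ℤ₂ → Carrier
  difference (a , b) = ι a - ι b

  -- The interpretation agrees with `difference`, but sends (n , 0) to ι n,
  -- so that the constant (1 , 0) is interpreted as 1# on the nose.
  ⟦_⟧ : ℤ₂ → Carrier
  ⟦ a , zero ⟧  = ι a
  ⟦ a , suc b ⟧ = difference (a , suc b)

  ⟦⟧≈difference : ∀ p → ⟦ p ⟧ ≈ difference p
  ⟦⟧≈difference (a , zero)  = sym (trans (+-congˡ -0#≈0#) (+-identityʳ _))
  ⟦⟧≈difference (a , suc b) = refl

  difference-cong : ∀ a b c d → a ℕ.+ d ≡ c ℕ.+ b → difference (a , b) ≈ difference (c , d)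
  difference-cong a b c d eq = sub-cancel (begin
    ι a + ι d      ≈⟨ ×-homo-+ 1# a d ⟨
    ι (a ℕ.+ d)    ≡⟨ ≡.cong ι eq ⟩
    ι (c ℕ.+ b)    ≈⟨ ×-homo-+ 1# c b ⟩
    ι c + ι b      ∎)

  ∸-balance : ∀ a b → (a ∸ b) ℕ.+ b ≡ a ℕ.+ (b ∸ a)
  ∸-balance zero    zero    = ≡.refl
  ∸-balance zero    (suc b) = ≡.refl
  ∸-balance (suc a) zero    = ≡.refl
  ∸-balance (suc a) (suc b) = ≡.trans (ℕP.+-suc (a ∸ b) b) (≡.cong suc (∸-balance a b))

  ⟦normalise⟧ : ∀ p → ⟦ normalise p ⟧ ≈ difference p
  ⟦normalise⟧ (a , b) = trans (⟦⟧≈difference (normalise (a , b))) (difference-cong (a ∸ b) (b ∸ a) a b (∸-balance a b))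

  -- Sum, product and negation of differences; no setoid structure is needed,
  -- since the solver only compares coefficients through `decide` below.
  Coefficients : RawRing 0ℓ 0ℓ
  Coefficients = record
    { Carrier = ℤ₂
    ; _≈_     = _≡_
    ; _+_     = λ { (a , b) (c , d) → normalise (a ℕ.+ c , b ℕ.+ d) }
    ; _*_     = λ { (a , b) (c , d) → normalise (a ℕ.* c ℕ.+ b ℕ.* d , a ℕ.* d ℕ.+ b ℕ.* c) }
    ; -_      = λ { (a , b) → (b , a) }
    ; 0#      = (0 , 0)
    ; 1#      = (1 , 0)
    }

  +-homo : ∀ a b c d → ⟦ normalise (a ℕ.+ c , b ℕ.+ d) ⟧ ≈ ⟦ a , b ⟧ + ⟦ c , d ⟧
  +-homo a b c d = begin
    ⟦ normalise (a ℕ.+ c , b ℕ.+ d) ⟧     ≈⟨ ⟦normalise⟧ (a ℕ.+ c , b ℕ.+ d) ⟩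
    ι (a ℕ.+ c) - ι (b ℕ.+ d)             ≈⟨ +-cong (×-homo-+ 1# a c) (-‿cong (×-homo-+ 1# b d)) ⟩
    (A + C) - (B + D)                     ≈⟨ sub-+-interchange A B C D ⟩
    (A - B) + (C - D)                     ≈⟨ +-cong (⟦⟧≈difference (a , b)) (⟦⟧≈difference (c , d)) ⟨
    ⟦ a , b ⟧ + ⟦ c , d ⟧                 ∎
    where A = ι a ; B = ι b ; C = ι c ; D = ι d

  *-homo : ∀ a b c d → ⟦ normalise (a ℕ.* c ℕ.+ b ℕ.* d , a ℕ.* d ℕ.+ b ℕ.* c) ⟧ ≈ ⟦ a , b ⟧ * ⟦ c , d ⟧
  *-homo a b c d = begin
    ⟦ normalise (a ℕ.* c ℕ.+ b ℕ.* d , a ℕ.* d ℕ.+ b ℕ.* c) ⟧   ≈⟨ ⟦normalise⟧ (a ℕ.* c ℕ.+ b ℕ.* d , a ℕ.* d ℕ.+ b ℕ.* c) ⟩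
    ι (a ℕ.* c ℕ.+ b ℕ.* d) - ι (a ℕ.* d ℕ.+ b ℕ.* c)           ≈⟨ +-cong (expand a c b d) (-‿cong (expand a d b c)) ⟩
    (A * C + B * D) - (A * D + B * C)                           ≈⟨ sub-*-expand A B C D ⟩
    (A - B) * (C - D)                                           ≈⟨ *-cong (⟦⟧≈difference (a , b)) (⟦⟧≈difference (c , d)) ⟨
    ⟦ a , b ⟧ * ⟦ c , d ⟧                                       ∎
    where
    A = ι a ; B = ι b ; C = ι c ; D = ι d
    expand : ∀ m n o p → ι (m ℕ.* n ℕ.+ o ℕ.* p) ≈ ι m * ι n + ι o * ι p
    expand m n o p = trans (×-homo-+ 1# (m ℕ.* n) (o ℕ.* p)) (+-cong (×1-homo-* m n) (×1-homo-* o p))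

  homomorphism : Coefficients -Raw-AlmostCommutative⟶ fromCommutativeRing R
  homomorphism = record
    { ⟦_⟧    = ⟦_⟧
    ; +-homo = λ { (a , b) (c , d) → +-homo a b c d }
    ; *-homo = λ { (a , b) (c , d) → *-homo a b c d }
    ; -‿homo = λ { (a , b) → begin
        ⟦ b , a ⟧             ≈⟨ ⟦⟧≈difference (b , a) ⟩
        difference (b , a)    ≈⟨ ⁻¹-anti-homo‿- (ι a) (ι b) ⟨
        - difference (a , b)  ≈⟨ -‿cong (⟦⟧≈difference (a , b)) ⟨
        - ⟦ a , b ⟧           ∎ }
    ; 0-homo = refl
    ; 1-homo = refl
    }

  decide : ∀ p p′ → Maybe (⟦ p ⟧ ≈ ⟦ p′ ⟧)
  decide (a , b) (c , d) with a ℕ.+ d ℕ.≟ c ℕ.+ b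
  ... | yes eq = just (trans (⟦⟧≈difference (a , b)) (trans (difference-cong a b c d eq) (sym (⟦⟧≈difference (c , d)))))
  ... | no _   = nothing

  open import Algebra.Solver.Ring Coefficients (fromCommutativeRing R) homomorphism decide
    public using (Polynomial; solve; _:=_; _:+_; _:-_; _:*_; con)

module FieldFacts {a ℓ : Level} (F : Field a ℓ) where
  open Field F
  open FieldDefs F
  open IntegerCoefficientSolver commutativeRing
  open import Relation.Binary.Reasoning.Setoid setoid

  𝟙 : ∀ {n} → Polynomial n
  𝟙 = con (1 , 0)

  ⁻¹-inverseˡ : ∀ x → ¬ (x ≈ 0#) → x ⁻¹ * x ≈ 1#
  ⁻¹-inverseˡ x x≉0 = trans (*-comm _ _) (⁻¹-inverse x x≉0)

  nonzero-* : ∀ {x y} → ¬ (x ≈ 0#) → ¬ (y ≈ 0#) → ¬ (x * y ≈ 0#)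
  nonzero-* {x} {y} x≉0 y≉0 xy≈0 = y≉0 (begin
    y                 ≈⟨ *-identityˡ y ⟨
    1# * y            ≈⟨ *-congʳ (⁻¹-inverseˡ x x≉0) ⟨
    (x ⁻¹ * x) * y    ≈⟨ *-assoc _ _ _ ⟩
    x ⁻¹ * (x * y)    ≈⟨ *-congˡ xy≈0 ⟩
    x ⁻¹ * 0#         ≈⟨ zeroʳ _ ⟩
    0#                ∎)

  divide-by-product : ∀ {g x y n} → ¬ (x ≈ 0#) → ¬ (y ≈ 0#) →
                      g * (x * y) ≈ n → n * (x ⁻¹ * y ⁻¹) ≈ g
  divide-by-product {g} {x} {y} {n} x≉0 y≉0 g[xy]≈n = begin
    n * (x ⁻¹ * y ⁻¹)                  ≈⟨ *-congʳ g[xy]≈n ⟨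
    g * (x * y) * (x ⁻¹ * y ⁻¹)        ≈⟨ solve 5 (λ g x y x′ y′ → g :* (x :* y) :* (x′ :* y′) := g :* ((x :* x′) :* (y :* y′))) refl g x y (x ⁻¹) (y ⁻¹) ⟩
    g * ((x * x ⁻¹) * (y * y ⁻¹))      ≈⟨ *-congˡ (*-cong (⁻¹-inverse x x≉0) (⁻¹-inverse y y≉0)) ⟩
    g * (1# * 1#)                      ≈⟨ solve 1 (λ g → g :* (𝟙 :* 𝟙) := g) refl g ⟩
    g                                  ∎

  pow-cong : ∀ {x y} n → x ≈ y → pow x n ≈ pow y n
  pow-cong zero    x≈y = refl
  pow-cong (suc n) x≈y = *-cong (pow-cong n x≈y) x≈y

  pow-≡ : ∀ x {m n} → m ≡ n → pow x m ≈ pow x n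
  pow-≡ x ≡.refl = refl

  pow-+ : ∀ x m n → pow x (m ℕ.+ n) ≈ pow x m * pow x n
  pow-+ x zero    n = sym (*-identityˡ _)
  pow-+ x (suc m) n = begin
    pow x (m ℕ.+ n) * x        ≈⟨ *-congʳ (pow-+ x m n) ⟩
    pow x m * pow x n * x      ≈⟨ solve 3 (λ a b x → a :* b :* x := a :* x :* b) refl (pow x m) (pow x n) x ⟩
    pow x m * x * pow x n      ∎

  pow-distrib-* : ∀ x y n → pow x n * pow y n ≈ pow (x * y) n
  pow-distrib-* x y zero    = *-identityˡ 1#
  pow-distrib-* x y (suc n) = begin
    pow x n * x * (pow y n * y)   ≈⟨ solve 4 (λ a x b y → a :* x :* (b :* y) := a :* b :* (x :* y)) refl (pow x n) x (pow y n) y ⟩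
    pow x n * pow y n * (x * y)   ≈⟨ *-congʳ (pow-distrib-* x y n) ⟩
    pow (x * y) n * (x * y)       ∎

  pow-1# : ∀ n → pow 1# n ≈ 1#
  pow-1# zero    = refl
  pow-1# (suc n) = trans (*-identityʳ _) (pow-1# n)

  pow-⁻¹ : ∀ {x} → ¬ (x ≈ 0#) → ∀ n → pow (x ⁻¹) n * pow x n ≈ 1#
  pow-⁻¹ {x} x≉0 n = begin
    pow (x ⁻¹) n * pow x n    ≈⟨ pow-distrib-* (x ⁻¹) x n ⟩
    pow (x ⁻¹ * x) n          ≈⟨ pow-cong n (⁻¹-inverseˡ x x≉0) ⟩
    pow 1# n                  ≈⟨ pow-1# n ⟩
    1#                        ∎

  poch-cong : ∀ {x y} z n → x ≈ y → poch x z n ≈ poch y z n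
  poch-cong z zero    x≈y = refl
  poch-cong z (suc n) x≈y = *-cong (poch-cong z n x≈y) (+-congˡ (-‿cong (*-congʳ x≈y)))

  poch-shift : ∀ x y n → poch x y (suc n) ≈ (1# - x) * poch (x * y) y n
  poch-shift x y zero    = solve 1 (λ x → 𝟙 :* (𝟙 :- x :* 𝟙) := (𝟙 :- x) :* 𝟙) refl x
  poch-shift x y (suc n) = begin
    poch x y (suc n) * (1# - x * (pow y n * y))               ≈⟨ *-congʳ (poch-shift x y n) ⟩
    (1# - x) * poch (x * y) y n * (1# - x * (pow y n * y))    ≈⟨ solve 4 (λ x P y Y → (𝟙 :- x) :* P :* (𝟙 :- x :* (Y :* y)) := (𝟙 :- x) :* (P :* (𝟙 :- x :* y :* Y))) refl x (poch (x * y) y n) y (pow y n) ⟩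
    (1# - x) * (poch (x * y) y n * (1# - x * y * pow y n))    ∎

  poch-telescope : ∀ x y s → poch x y (suc s) + x * sumTo s (λ k → poch x y k * pow y k) ≈ 1#
  poch-telescope x y zero    = solve 1 (λ x → 𝟙 :* (𝟙 :- x :* 𝟙) :+ x :* (𝟙 :* 𝟙) := 𝟙) refl x
  poch-telescope x y (suc s) = begin
    P * (1# - x * Y) + x * (S + P * Y)    ≈⟨ solve 4 (λ P x Y S → P :* (𝟙 :- x :* Y) :+ x :* (S :+ P :* Y) := P :+ x :* S) refl P x Y S ⟩
    P + x * S                             ≈⟨ poch-telescope x y s ⟩
    1#                                    ∎
    where
    P = poch x y (suc s)
    Y = pow y (suc s)
    S = sumTo s (λ k → poch x y k * pow y k)

  poch-weighted-sum : ∀ {x x′} y → x * x′ ≈ 1# → ∀ r →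
                      sumTo r (λ k → pow y k * poch x y k) ≈ (1# - x′) * poch (x * y) y r + x′
  poch-weighted-sum {x′ = x′} y _ zero = solve 1 (λ x′ → 𝟙 :* 𝟙 := (𝟙 :- x′) :* 𝟙 :+ x′) refl x′
  poch-weighted-sum {x} {x′} y xx′≈1 (suc r) = begin
    sumTo r (λ k → pow y k * poch x y k) + Y * y * poch x y (suc r)
      ≈⟨ +-cong (poch-weighted-sum y xx′≈1 r) (*-congˡ (poch-shift x y r)) ⟩
    ((1# - x′) * P + x′) + Y * y * ((1# - x) * P)
      ≈⟨ +-congˡ (*-congˡ (*-congʳ (+-congʳ xx′≈1))) ⟨
    ((1# - x′) * P + x′) + Y * y * ((x * x′ - x) * P)
      ≈⟨ solve 5 (λ x x′ P Y y → ((𝟙 :- x′) :* P :+ x′) :+ Y :* y :* ((x :* x′ :- x) :* P) := (𝟙 :- x′) :* (P :* (𝟙 :- x :* y :* Y)) :+ x′) refl x x′ P Y y ⟩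
    (1# - x′) * poch (x * y) y (suc r) + x′ ∎
    where
    Y = pow y r
    P = poch (x * y) y r

  sumTo-cong : ∀ n {f g : ℕ → Carrier} → (∀ k → k ℕ.≤ n → f k ≈ g k) → sumTo n f ≈ sumTo n g
  sumTo-cong zero    f≈g = f≈g 0 ℕ.z≤n
  sumTo-cong (suc n) f≈g = +-cong (sumTo-cong n (λ k k≤n → f≈g k (ℕP.m≤n⇒m≤1+n k≤n))) (f≈g (suc n) ℕP.≤-refl)

  sumTo-linear : ∀ n w {f g h : ℕ → Carrier} → (∀ k → k ℕ.≤ n → f k ≈ g k + w * h k) →
                 sumTo n f ≈ sumTo n g + w * sumTo n h
  sumTo-linear zero    w f≈g+wh = f≈g+wh 0 ℕ.z≤n
  sumTo-linear (suc n) w {f} {g} {h} f≈g+wh = begin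
    sumTo n f + f (suc n)
      ≈⟨ +-cong (sumTo-linear n w (λ k k≤n → f≈g+wh k (ℕP.m≤n⇒m≤1+n k≤n))) (f≈g+wh (suc n) ℕP.≤-refl) ⟩
    (sumTo n g + w * sumTo n h) + (g (suc n) + w * h (suc n))
      ≈⟨ solve 5 (λ G H w g h → (G :+ w :* H) :+ (g :+ w :* h) := (G :+ g) :+ w :* (H :+ h)) refl (sumTo n g) (sumTo n h) w (g (suc n)) (h (suc n)) ⟩
    sumTo (suc n) g + w * sumTo (suc n) h ∎

  Pascal : (ℕ → Carrier) → (ℕ → ℕ → Carrier) → Set ℓ
  Pascal w f = ∀ r s → f (suc r) (suc s) ≈ f r (suc s) + w r * f (suc r) s

  pascal-unique : ∀ w (f g : ℕ → ℕ → Carrier) → Pascal w f → Pascal w g →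
                  (∀ s → f 0 s ≈ g 0 s) → (∀ r → f r 0 ≈ g r 0) → ∀ r s → f r s ≈ g r s
  pascal-unique w f g f-rec g-rec f≈g-left f≈g-bottom = f≈g
    where
    f≈g : ∀ r s → f r s ≈ g r s
    f≈g zero    s       = f≈g-left s
    f≈g (suc r) zero    = f≈g-bottom (suc r)
    f≈g (suc r) (suc s) = begin
      f (suc r) (suc s)                 ≈⟨ f-rec r s ⟩
      f r (suc s) + w r * f (suc r) s   ≈⟨ +-cong (f≈g r (suc s)) (*-congˡ (f≈g (suc r) s)) ⟩
      g r (suc s) + w r * g (suc r) s   ≈⟨ g-rec r s ⟨
      g (suc r) (suc s)                 ∎

module Gaussian {a ℓ : Level} (F : Field a ℓ) (q : Field.Carrier F) where
  open Field F
  open FieldDefs F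
  open FieldFacts F
  open IntegerCoefficientSolver commutativeRing
  open import Relation.Binary.Reasoning.Setoid setoid

  -- gauss a b = [a+b choose a]_q, by the q-Pascal rule.
  gauss : ℕ → ℕ → Carrier
  gauss zero    b       = 1#
  gauss (suc a) zero    = 1#
  gauss (suc a) (suc b) = gauss a (suc b) + pow q (suc a) * gauss (suc a) b

  gauss-zeroʳ : ∀ a → gauss a 0 ≈ 1#
  gauss-zeroʳ zero    = refl
  gauss-zeroʳ (suc a) = refl

  factorial : ℕ → Carrier
  factorial n = poch q q n

  factorial-≡ : ∀ {m n} → m ≡ n → factorial m ≈ factorial n
  factorial-≡ ≡.refl = refl

  gauss-factorial : ∀ a b → gauss a b * (factorial a * factorial b) ≈ factorial (a ℕ.+ b)
  gauss-factorial zero    b    = trans (*-identityˡ _) (*-identityˡ _)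
  gauss-factorial (suc a) zero =
    trans (*-identityˡ _) (trans (*-identityʳ _) (factorial-≡ (≡.sym (ℕP.+-identityʳ (suc a)))))
  gauss-factorial (suc a) (suc b) = begin
    (G₁ + (Qa * q) * G₂) * ((Fa * (1# - q * Qa)) * (Fb * (1# - q * Qb)))
      ≈⟨ solve 8 (λ G₁ G₂ Qa q Fa Fb y₁ y₂ → (G₁ :+ (Qa :* q) :* G₂) :* ((Fa :* y₁) :* (Fb :* y₂)) := (G₁ :* (Fa :* (Fb :* y₂))) :* y₁ :+ (Qa :* q) :* ((G₂ :* ((Fa :* y₁) :* Fb)) :* y₂)) refl G₁ G₂ Qa q Fa Fb (1# - q * Qa) (1# - q * Qb) ⟩
    (G₁ * (Fa * (Fb * (1# - q * Qb)))) * (1# - q * Qa) + (Qa * q) * ((G₂ * ((Fa * (1# - q * Qa)) * Fb)) * (1# - q * Qb))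
      ≈⟨ +-cong (*-congʳ (trans (gauss-factorial a (suc b)) (factorial-≡ (ℕP.+-suc a b)))) (*-congˡ (*-congʳ (gauss-factorial (suc a) b))) ⟩
    N * (1# - q * Qa) + (Qa * q) * (N * (1# - q * Qb))
      ≈⟨ solve 4 (λ N q Qa Qb → N :* (𝟙 :- q :* Qa) :+ (Qa :* q) :* (N :* (𝟙 :- q :* Qb)) := N :* (𝟙 :- q :* (Qa :* Qb :* q))) refl N q Qa Qb ⟩
    N * (1# - q * (Qa * Qb * q))
      ≈⟨ *-congˡ (+-congˡ (-‿cong (*-congˡ (*-congʳ (pow-+ q a b))))) ⟨
    factorial (suc (suc (a ℕ.+ b)))
      ≈⟨ factorial-≡ (≡.cong suc (ℕP.+-suc a b)) ⟨
    factorial (suc a ℕ.+ suc b) ∎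
    where
    G₁ = gauss a (suc b)
    G₂ = gauss (suc a) b
    Qa = pow q a
    Qb = pow q b
    Fa = factorial a
    Fb = factorial b
    N  = factorial (suc (a ℕ.+ b))

  module _ (1-qⁿ⁺¹≉0 : ∀ n → ¬ (1# - pow q (suc n) ≈ 0#)) where

    factorial-nonzero : ∀ n → ¬ (factorial n ≈ 0#)
    factorial-nonzero zero    1≈0 = 0≉1 (sym 1≈0)
    factorial-nonzero (suc n) =
      nonzero-* (factorial-nonzero n) (λ 1-q·qⁿ≈0 → 1-qⁿ⁺¹≉0 n (trans (+-congˡ (-‿cong (*-comm _ _))) 1-q·qⁿ≈0))

    qbinom≈gaussˡ : ∀ a b → qbinom q (a ℕ.+ b) a ≈ gauss a b
    qbinom≈gaussˡ a b = begin
      factorial (a ℕ.+ b) * (factorial a ⁻¹ * factorial (a ℕ.+ b ∸ a) ⁻¹)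
        ≡⟨ ≡.cong (λ m → factorial (a ℕ.+ b) * (factorial a ⁻¹ * factorial m ⁻¹)) (ℕP.m+n∸m≡n a b) ⟩
      factorial (a ℕ.+ b) * (factorial a ⁻¹ * factorial b ⁻¹)
        ≈⟨ divide-by-product (factorial-nonzero a) (factorial-nonzero b) (gauss-factorial a b) ⟩
      gauss a b ∎

    qbinom≈gaussʳ : ∀ a b → qbinom q (a ℕ.+ b) b ≈ gauss a b
    qbinom≈gaussʳ a b = begin
      factorial (a ℕ.+ b) * (factorial b ⁻¹ * factorial (a ℕ.+ b ∸ b) ⁻¹)
        ≡⟨ ≡.cong (λ m → factorial (a ℕ.+ b) * (factorial b ⁻¹ * factorial m ⁻¹)) (ℕP.m+n∸n≡m a b) ⟩
      factorial (a ℕ.+ b) * (factorial b ⁻¹ * factorial a ⁻¹)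
        ≈⟨ divide-by-product (factorial-nonzero b) (factorial-nonzero a) (trans (*-congˡ (*-comm _ _)) (gauss-factorial a b)) ⟩
      gauss a b ∎

module BothSides {a ℓ : Level} (F : Field a ℓ) (q c : Field.Carrier F)
                 (q≉0 : ¬ (Field._≈_ F q (Field.0# F))) (c≉0 : ¬ (Field._≈_ F c (Field.0# F))) where
  open Field F
  open FieldDefs F
  open FieldFacts F
  open Gaussian F q
  open IntegerCoefficientSolver commutativeRing
  open import Relation.Binary.Reasoning.Setoid setoid

  c⁻¹ q⁻¹ : Carrier
  c⁻¹ = c ⁻¹
  q⁻¹ = q ⁻¹

  weight : ℕ → Carrier
  weight r = pow q (suc r)

  gauss-diagonal : ∀ r b → gauss (r ∸ r) b ≈ 1#
  gauss-diagonal r b = reflexive (≡.cong (λ m → gauss m b) (ℕP.n∸n≡0 r))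

  lhsTerm : ℕ → ℕ → ℕ → Carrier
  lhsTerm r s k = gauss (r ∸ k) s * (pow q ((s ℕ.+ 1) ℕ.* k) * poch c q k)

  lhs : ℕ → ℕ → Carrier
  lhs r s = sumTo r (lhsTerm r s)

  rhsTerm : ℕ → ℕ → ℕ → Carrier
  rhsTerm r s k = gauss r (s ∸ k) * (poch c⁻¹ q⁻¹ k * pow q⁻¹ k)

  rhsProduct : ℕ → ℕ → Carrier
  rhsProduct r s = poch c⁻¹ q⁻¹ (1 ℕ.+ s) * poch (c * pow q (1 ℕ.+ s)) q r

  rhs : ℕ → ℕ → Carrier
  rhs r s = rhsProduct r s + c⁻¹ * sumTo s (rhsTerm r s)

  exponent-shift : ∀ r s k → k ℕ.≤ r →
                   pow q (suc (r ∸ k)) * pow q ((suc s ℕ.+ 1) ℕ.* k) ≈ weight r * pow q ((s ℕ.+ 1) ℕ.* k)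
  exponent-shift r s k k≤r = begin
    pow q (suc (r ∸ k)) * pow q ((suc s ℕ.+ 1) ℕ.* k)   ≈⟨ pow-+ q (suc (r ∸ k)) _ ⟨
    pow q (suc (r ∸ k) ℕ.+ (suc s ℕ.+ 1) ℕ.* k)         ≈⟨ pow-≡ q exponents ⟩
    pow q (suc r ℕ.+ (s ℕ.+ 1) ℕ.* k)                   ≈⟨ pow-+ q (suc r) _ ⟩
    weight r * pow q ((s ℕ.+ 1) ℕ.* k)                  ∎
    where
    regroup : ∀ e → suc e ℕ.+ (suc s ℕ.+ 1) ℕ.* k ≡ suc (e ℕ.+ k) ℕ.+ (s ℕ.+ 1) ℕ.* k
    regroup e = ℕsolve (e ∷ s ∷ k ∷ [])
    exponents : suc (r ∸ k) ℕ.+ (suc s ℕ.+ 1) ℕ.* k ≡ suc r ℕ.+ (s ℕ.+ 1) ℕ.* k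
    exponents = ≡.trans (regroup (r ∸ k)) (≡.cong (λ m → suc m ℕ.+ (s ℕ.+ 1) ℕ.* k) (ℕP.m∸n+n≡m k≤r))

  lhsTerm-pascal : ∀ r s k → k ℕ.≤ r →
                   lhsTerm (suc r) (suc s) k ≈ lhsTerm r (suc s) k + weight r * lhsTerm (suc r) s k
  lhsTerm-pascal r s k k≤r = begin
    gauss (suc r ∸ k) (suc s) * (W′ * C)
      ≡⟨ ≡.cong (λ m → gauss m (suc s) * (W′ * C)) (ℕP.+-∸-assoc 1 k≤r) ⟩
    (gauss e (suc s) + pow q (suc e) * gauss (suc e) s) * (W′ * C)
      ≈⟨ solve 5 (λ A B x w C → (A :+ x :* B) :* (w :* C) := A :* (w :* C) :+ (x :* w) :* (B :* C)) refl (gauss e (suc s)) (gauss (suc e) s) (pow q (suc e)) W′ C ⟩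
    gauss e (suc s) * (W′ * C) + (pow q (suc e) * W′) * (gauss (suc e) s * C)
      ≈⟨ +-congˡ (*-congʳ (exponent-shift r s k k≤r)) ⟩
    gauss e (suc s) * (W′ * C) + (weight r * W) * (gauss (suc e) s * C)
      ≈⟨ +-congˡ (solve 4 (λ x w B C → (x :* w) :* (B :* C) := x :* (B :* (w :* C))) refl (weight r) W (gauss (suc e) s) C) ⟩
    gauss e (suc s) * (W′ * C) + weight r * (gauss (suc e) s * (W * C))
      ≡⟨ ≡.cong (λ m → gauss e (suc s) * (W′ * C) + weight r * (gauss m s * (W * C))) (ℕP.+-∸-assoc 1 k≤r) ⟨
    lhsTerm r (suc s) k + weight r * lhsTerm (suc r) s k ∎
    where
    e = r ∸ k
    C = poch c q k
    W = pow q ((s ℕ.+ 1) ℕ.* k)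
    W′ = pow q ((suc s ℕ.+ 1) ℕ.* k)

  lhsTerm-last : ∀ r s → lhsTerm (suc r) (suc s) (suc r) ≈ weight r * lhsTerm (suc r) s (suc r)
  lhsTerm-last r s = begin
    gauss (r ∸ r) (suc s) * (pow q ((suc s ℕ.+ 1) ℕ.* suc r) * C)
      ≈⟨ *-cong (gauss-diagonal r (suc s)) (*-congʳ (pow-≡ q exponent)) ⟩
    1# * (pow q (suc r ℕ.+ (s ℕ.+ 1) ℕ.* suc r) * C)
      ≈⟨ *-congˡ (*-congʳ (pow-+ q (suc r) _)) ⟩
    1# * (weight r * W * C)
      ≈⟨ solve 3 (λ w W C → 𝟙 :* (w :* W :* C) := w :* (𝟙 :* (W :* C))) refl (weight r) W C ⟩
    weight r * (1# * (W * C))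
      ≈⟨ *-congˡ (*-congʳ (gauss-diagonal r s)) ⟨
    weight r * lhsTerm (suc r) s (suc r) ∎
    where
    C = poch c q (suc r)
    W = pow q ((s ℕ.+ 1) ℕ.* suc r)
    exponent : (suc s ℕ.+ 1) ℕ.* suc r ≡ suc r ℕ.+ (s ℕ.+ 1) ℕ.* suc r
    exponent = ℕsolve (r ∷ s ∷ [])

  lhs-pascal : Pascal weight lhs
  lhs-pascal r s = begin
    sumTo r (lhsTerm (suc r) (suc s)) + lhsTerm (suc r) (suc s) (suc r)
      ≈⟨ +-cong (sumTo-linear r (weight r) (lhsTerm-pascal r s)) (lhsTerm-last r s) ⟩
    (lhs r (suc s) + weight r * sumTo r (lhsTerm (suc r) s)) + weight r * lhsTerm (suc r) s (suc r)
      ≈⟨ solve 4 (λ A w B x → A :+ w :* B :+ w :* x := A :+ w :* (B :+ x)) refl (lhs r (suc s)) (weight r) (sumTo r (lhsTerm (suc r) s)) (lhsTerm (suc r) s (suc r)) ⟩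
    lhs r (suc s) + weight r * lhs (suc r) s ∎

  rhsTerm-pascal : ∀ r s k → k ℕ.≤ s →
                   rhsTerm (suc r) (suc s) k ≈ rhsTerm r (suc s) k + weight r * rhsTerm (suc r) s k
  rhsTerm-pascal r s k k≤s = begin
    gauss (suc r) (suc s ∸ k) * V
      ≡⟨ ≡.cong (λ m → gauss (suc r) m * V) (ℕP.+-∸-assoc 1 k≤s) ⟩
    (gauss r (suc (s ∸ k)) + weight r * gauss (suc r) (s ∸ k)) * V
      ≈⟨ solve 4 (λ A w B V → (A :+ w :* B) :* V := A :* V :+ w :* (B :* V)) refl (gauss r (suc (s ∸ k))) (weight r) (gauss (suc r) (s ∸ k)) V ⟩
    gauss r (suc (s ∸ k)) * V + weight r * (gauss (suc r) (s ∸ k) * V)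
      ≡⟨ ≡.cong (λ m → gauss r m * V + weight r * rhsTerm (suc r) s k) (ℕP.+-∸-assoc 1 k≤s) ⟨
    rhsTerm r (suc s) k + weight r * rhsTerm (suc r) s k ∎
    where V = poch c⁻¹ q⁻¹ k * pow q⁻¹ k

  rhsTerm-last : ∀ r s → rhsTerm (suc r) (suc s) (suc s) ≈ rhsTerm r (suc s) (suc s)
  rhsTerm-last r s = *-congʳ (begin
    gauss (suc r) (s ∸ s) ≡⟨ ≡.cong (gauss (suc r)) (ℕP.n∸n≡0 s) ⟩
    gauss (suc r) 0       ≈⟨ gauss-zeroʳ r ⟨
    gauss r 0             ≡⟨ ≡.cong (gauss r) (ℕP.n∸n≡0 s) ⟨
    gauss r (s ∸ s)       ∎)

  rhsSum-pascal : Pascal weight (λ r s → sumTo s (rhsTerm r s))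
  rhsSum-pascal r s = begin
    sumTo s (rhsTerm (suc r) (suc s)) + rhsTerm (suc r) (suc s) (suc s)
      ≈⟨ +-cong (sumTo-linear s (weight r) (rhsTerm-pascal r s)) (rhsTerm-last r s) ⟩
    (A + weight r * B) + rhsTerm r (suc s) (suc s)
      ≈⟨ solve 4 (λ A w B x → A :+ w :* B :+ x := A :+ x :+ w :* B) refl A (weight r) B (rhsTerm r (suc s) (suc s)) ⟩
    sumTo (suc s) (rhsTerm r (suc s)) + weight r * sumTo s (rhsTerm (suc r) s) ∎
    where
    A = sumTo s (rhsTerm r (suc s))
    B = sumTo s (rhsTerm (suc r) s)

  inverse-powers : ∀ n → (c⁻¹ * pow q⁻¹ n) * (c * pow q n) ≈ 1#
  inverse-powers n = begin
    (c⁻¹ * pow q⁻¹ n) * (c * pow q n)    ≈⟨ solve 4 (λ c′ P c Q → (c′ :* P) :* (c :* Q) := (c′ :* c) :* (P :* Q)) refl c⁻¹ (pow q⁻¹ n) c (pow q n) ⟩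
    (c⁻¹ * c) * (pow q⁻¹ n * pow q n)    ≈⟨ *-cong (⁻¹-inverseˡ c c≉0) (pow-⁻¹ q≉0 n) ⟩
    1# * 1#                              ≈⟨ *-identityˡ 1# ⟩
    1#                                   ∎

  -- So does the product term of R: expand the last factor of
  -- (cq^{s+2};q)_{r+1} and cancel c⁻¹q^{-(s+1)} against cq^{s+1}.
  rhsProduct-pascal : Pascal weight rhsProduct
  rhsProduct-pascal r s = begin
    (X * (1# - c⁻¹ * P)) * (E * (1# - (c * (Q * q)) * Qr))
      ≈⟨ solve 8 (λ X c′ P E c Q q Qr → (X :* (𝟙 :- c′ :* P)) :* (E :* (𝟙 :- (c :* (Q :* q)) :* Qr)) := (X :* (𝟙 :- c′ :* P)) :* E :+ (Qr :* q) :* (X :* (((c′ :* P) :* (c :* Q) :- c :* Q) :* E))) refl X c⁻¹ P E c Q q Qr ⟩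
    (X * (1# - c⁻¹ * P)) * E + (Qr * q) * (X * (((c⁻¹ * P) * (c * Q) - c * Q) * E))
      ≈⟨ +-congˡ (*-congˡ (*-congˡ (*-cong (+-congʳ (inverse-powers (suc s))) (sym (poch-cong q r (*-assoc c Q q)))))) ⟩
    (X * (1# - c⁻¹ * P)) * E + (Qr * q) * (X * ((1# - c * Q) * poch ((c * Q) * q) q r))
      ≈⟨ +-congˡ (*-congˡ (*-congˡ (poch-shift (c * Q) q r))) ⟨
    rhsProduct r (suc s) + weight r * rhsProduct (suc r) s ∎
    where
    X = poch c⁻¹ q⁻¹ (suc s)
    P = pow q⁻¹ (suc s)
    Q = pow q (suc s)
    Qr = pow q r
    E = poch (c * (Q * q)) q r

  rhs-pascal : Pascal weight rhs
  rhs-pascal r s = begin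
    rhsProduct (suc r) (suc s) + c⁻¹ * sumTo (suc s) (rhsTerm (suc r) (suc s))
      ≈⟨ +-cong (rhsProduct-pascal r s) (*-congˡ (rhsSum-pascal r s)) ⟩
    (A + w * B) + c⁻¹ * (A′ + w * B′)
      ≈⟨ solve 6 (λ A B A′ B′ c′ w → (A :+ w :* B) :+ c′ :* (A′ :+ w :* B′) := (A :+ c′ :* A′) :+ w :* (B :+ c′ :* B′)) refl A B A′ B′ c⁻¹ w ⟩
    rhs r (suc s) + w * rhs (suc r) s ∎
    where
    w = weight r
    A = rhsProduct r (suc s)
    B = rhsProduct (suc r) s
    A′ = sumTo (suc s) (rhsTerm r (suc s))
    B′ = sumTo s (rhsTerm (suc r) s)

  lhs-left : ∀ s → lhs 0 s ≈ 1#
  lhs-left s = begin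
    1# * (pow q ((s ℕ.+ 1) ℕ.* 0) * 1#)   ≈⟨ *-congˡ (*-congʳ (pow-≡ q (ℕP.*-zeroʳ (s ℕ.+ 1)))) ⟩
    1# * (1# * 1#)                        ≈⟨ solve 0 (𝟙 :* (𝟙 :* 𝟙) := 𝟙) refl ⟩
    1#                                    ∎

  rhs-left : ∀ s → rhs 0 s ≈ 1#
  rhs-left s = begin
    poch c⁻¹ q⁻¹ (suc s) * 1# + c⁻¹ * sumTo s (λ k → 1# * V k)
      ≈⟨ +-cong (*-identityʳ _) (*-congˡ (sumTo-cong s (λ k _ → *-identityˡ (V k)))) ⟩
    poch c⁻¹ q⁻¹ (suc s) + c⁻¹ * sumTo s V
      ≈⟨ poch-telescope c⁻¹ q⁻¹ s ⟩
    1# ∎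
    where
    V : ℕ → Carrier
    V k = poch c⁻¹ q⁻¹ k * pow q⁻¹ k

  lhs-bottom : ∀ r → lhs r 0 ≈ (1# - c⁻¹) * poch (c * q) q r + c⁻¹
  lhs-bottom r = begin
    sumTo r (lhsTerm r 0)
      ≈⟨ sumTo-cong r (λ k _ → trans (*-cong (gauss-zeroʳ (r ∸ k)) (*-congʳ (pow-≡ q (ℕP.*-identityˡ k)))) (*-identityˡ _)) ⟩
    sumTo r (λ k → pow q k * poch c q k)
      ≈⟨ poch-weighted-sum q (⁻¹-inverse c c≉0) r ⟩
    (1# - c⁻¹) * poch (c * q) q r + c⁻¹ ∎

  rhs-bottom : ∀ r → rhs r 0 ≈ (1# - c⁻¹) * poch (c * q) q r + c⁻¹
  rhs-bottom r = begin
    (1# * (1# - c⁻¹ * 1#)) * poch (c * (1# * q)) q r + c⁻¹ * (gauss r 0 * (1# * 1#))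
      ≈⟨ +-cong (*-congˡ (poch-cong q r (*-congˡ (*-identityˡ q)))) (*-congˡ (*-congʳ (gauss-zeroʳ r))) ⟩
    (1# * (1# - c⁻¹ * 1#)) * poch (c * q) q r + c⁻¹ * (1# * (1# * 1#))
      ≈⟨ solve 2 (λ c′ P → (𝟙 :* (𝟙 :- c′ :* 𝟙)) :* P :+ c′ :* (𝟙 :* (𝟙 :* 𝟙)) := (𝟙 :- c′) :* P :+ c′) refl c⁻¹ (poch (c * q) q r) ⟩
    (1# - c⁻¹) * poch (c * q) q r + c⁻¹ ∎

  lhs≈rhs : ∀ r s → lhs r s ≈ rhs r s
  lhs≈rhs = pascal-unique weight lhs rhs lhs-pascal rhs-pascal
    (λ s → trans (lhs-left s) (sym (rhs-left s)))
    (λ r → trans (lhs-bottom r) (sym (rhs-bottom r)))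

  module _ (1-qⁿ⁺¹≉0 : ∀ n → ¬ (1# - pow q (suc n) ≈ 0#)) where

    lhs-from-qbinom : ∀ r s →
      sumTo r (λ k → qbinom q (r ℕ.+ s ∸ k) (r ∸ k) * (pow q ((s ℕ.+ 1) ℕ.* k) * poch c q k)) ≈ lhs r s
    lhs-from-qbinom r s = sumTo-cong r (λ k k≤r → *-congʳ (begin
      qbinom q (r ℕ.+ s ∸ k) (r ∸ k)      ≡⟨ ≡.cong (λ m → qbinom q m (r ∸ k)) (ℕP.+-∸-comm s k≤r) ⟩
      qbinom q (r ∸ k ℕ.+ s) (r ∸ k)      ≈⟨ qbinom≈gaussˡ 1-qⁿ⁺¹≉0 (r ∸ k) s ⟩
      gauss (r ∸ k) s                     ∎))

    rhsSum-from-qbinom : ∀ r s →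
      sumTo s (λ k → qbinom q (r ℕ.+ s ∸ k) (s ∸ k) * (poch c⁻¹ q⁻¹ k * pow q⁻¹ k)) ≈ sumTo s (rhsTerm r s)
    rhsSum-from-qbinom r s = sumTo-cong s (λ k k≤s → *-congʳ (begin
      qbinom q (r ℕ.+ s ∸ k) (s ∸ k)      ≡⟨ ≡.cong (λ m → qbinom q m (s ∸ k)) (ℕP.+-∸-assoc r k≤s) ⟩
      qbinom q (r ℕ.+ (s ∸ k)) (s ∸ k)    ≈⟨ qbinom≈gaussʳ 1-qⁿ⁺¹≉0 r (s ∸ k) ⟩
      gauss r (s ∸ k)                     ∎))

open import Data.Nat using (_+_; _*_)

corollary3p3 : ∀ {a ℓ : Level} (F : Field a ℓ) (q c : Field.Carrier F) →
  ¬ (Field._≈_ F q (Field.0# F)) →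
  (∀ (n : ℕ) → ¬ (Field._≈_ F (Field._-_ F (Field.1# F) (FieldDefs.pow F q (suc n))) (Field.0# F))) →
  ¬ (Field._≈_ F c (Field.0# F)) →
  (r s : ℕ) →
  Field._≈_ F
    (FieldDefs.sumTo F r (λ k →
       Field._*_ F (FieldDefs.qbinom F q (r + s ∸ k) (r ∸ k))
         (Field._*_ F (FieldDefs.pow F q ((s + 1) * k))
           (FieldDefs.poch F c q k))))
    (Field._+_ F
      (Field._*_ F (FieldDefs.poch F (Field._⁻¹ F c) (Field._⁻¹ F q) (1 + s))
        (FieldDefs.poch F (Field._*_ F c (FieldDefs.pow F q (1 + s))) q r))
      (Field._*_ F (Field._⁻¹ F c)
        (FieldDefs.sumTo F s (λ k →
           Field._*_ F (FieldDefs.qbinom F q (r + s ∸ k) (s ∸ k))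
             (Field._*_ F (FieldDefs.poch F (Field._⁻¹ F c) (Field._⁻¹ F q) k)
               (FieldDefs.pow F (Field._⁻¹ F q) k))))))
corollary3p3 F q c q≉0 1-qⁿ⁺¹≉0 c≉0 r s = begin
  _                  ≈⟨ lhs-from-qbinom 1-qⁿ⁺¹≉0 r s ⟩
  lhs r s            ≈⟨ lhs≈rhs r s ⟩
  rhs r s            ≈⟨ +-congˡ (*-congˡ (rhsSum-from-qbinom 1-qⁿ⁺¹≉0 r s)) ⟨
  _                  ∎
  where
  open Field F
  open BothSides F q c q≉0 c≉0
  open import Relation.Binary.Reasoning.Setoid setoid
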